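{- Let $r\geq 4$. Let $\mathcal{F}_r\subseteq\mathbb{R}^{\mathcal{P}([r])}$ be the set of all vectors $V$ of the form $V_T=(T(w)-T(x))(T(y)-T(z))$ for $T\subseteq[r]$, where $w,x,y,z$ are four distinct elements of $[r]$ and $T(u)=1$ if $u\in T$, $T(u)=0$ otherwise. Then there exists a linearly independent subset $\Gamma_r\subseteq\mathcal{F}_r$ with $|\Gamma_r|\geq\binom{r}{2}-r$.
   Context: $\mathcal{P}([r])$ is the power set of $[r]=\{1,\ldots,r\}$.
   Formalization: Linear independence of $\Gamma_r$ is taken over the rationals rather than the reals, with rational coefficients and the vectors of $\mathcal{F}_r$ having entries in ℚ. -}

module Defs where

open import Data.Nat using (ℕ; zero; suc)
open import Data.Bool using (Bool; true; false; if_then_else_)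
open import Data.Fin using (Fin; zero; suc)
open import Data.Fin.Subset using (Subset)
open import Data.Vec using (lookup)
open import Data.Rational using (ℚ; 0ℚ; 1ℚ; _+_; _-_; _*_)
open import Relation.Binary.PropositionalEquality using (_≡_)
open import Relation.Nullary using (¬_)

ind : {r : ℕ} → Subset r → Fin r → ℚ
ind T u = if lookup T u then 1ℚ else 0ℚ

record Quad (r : ℕ) : Set where
  constructor quad
  field
    w x y z : Fin r
    w≢x : ¬ (w ≡ x)
    w≢y : ¬ (w ≡ y)
    w≢z : ¬ (w ≡ z)
    x≢y : ¬ (x ≡ y)
    x≢z : ¬ (x ≡ z)
    y≢z : ¬ (y ≡ z)

vecF : {r : ℕ} → Quad r → Subset r → ℚ
vecF q T = (ind T (Quad.w q) - ind T (Quad.x q)) * (ind T (Quad.y q) - ind T (Quad.z q))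

sumFin : (n : ℕ) → (Fin n → ℚ) → ℚ
sumFin zero f = 0ℚ
sumFin (suc n) f = f zero + sumFin n (λ i → f (suc i))

LinIndep : {r : ℕ} (m : ℕ) → (Fin m → Subset r → ℚ) → Set
LinIndep {r} m v =
  (c : Fin m → ℚ) → ((T : Subset r) → sumFin m (λ i → c i * v i T) ≡ 0ℚ) → (i : Fin m) → c i ≡ 0ℚ

-- Induction on r, from the empty family at r = 3.  Passing from r to r + 1, the new element is
-- 0 and the old ones are 1, …, r.  Keep the old vectors (they ignore 0) and add the r - 1 vectors
-- of the quadruples (0, a, i, 1), 2 ≤ i ≤ r, with a ∉ {0, 1, i}.  The discrete derivative in the
-- new coordinate, V ↦ (S ↦ V(S ∪ {0}) - V(S)), kills the old vectors and sends the new ones to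
-- S ↦ S(i) - S(1), which are independent (evaluate at singletons).  So a vanishing combination
-- has zero new coefficients, and then zero old ones.  The count keeps up because
-- (r+1 choose 2) - (r+1) = (r choose 2) - r + (r - 1).
module Submission where

open import Defs
open import Data.Nat using (ℕ; _≤_; _∸_)
open import Data.Nat.Combinatorics using (_C_)
open import Data.Fin using (Fin)
open import Data.Product using (Σ; _×_)

open import Data.Nat as ℕ using (zero; suc; z≤n; s≤s)
open import Data.Nat.Properties using (+-monoʳ-≤; ≤-trans; m≤n+m∸n; m≤n+o⇒m∸n≤o; +-suc; module ≤-Reasoning)
open import Data.Nat.Combinatorics using (nC1≡n; nCk+nC[k+1]≡[n+1]C[k+1])
open import Data.Fin using (zero; suc; _↑ˡ_; _↑ʳ_; splitAt; join)
open import Data.Fin.Patterns using (0F; 1F; 2F)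
open import Data.Fin.Properties using (suc-injective; join-splitAt)
open import Data.Fin.Subset using (Subset; inside; outside; ⊥; ⁅_⁆)
open import Data.Product using (_,_)
open import Data.Sum using ([_,_]; inj₁; inj₂)
open import Data.Vec using (_∷_; tail)
open import Data.Vec.Properties using (lookup-replicate)
open import Data.Vec.Functional using (_++_)
open import Data.Vec.Functional.Properties using (lookup-++ˡ; lookup-++ʳ)
open import Data.Rational using (ℚ; 0ℚ; 1ℚ; _+_; _-_; _*_)
open import Data.Rational.Properties
  using (_≟_; +-*-commutativeRing; +-identityˡ; +-identityʳ; +-assoc; *-identityʳ; *-zeroˡ; *-zeroʳ)
open import Function using (_∘_)
open import Level using (0ℓ)
open import Relation.Binary.PropositionalEquality using (_≡_; _≢_; refl; sym; trans; cong; cong₂; subst; module ≡-Reasoning)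
open import Relation.Nullary.Decidable using (dec⇒maybe)
open import Tactic.RingSolver using (solve-∀)
open import Tactic.RingSolver.Core.AlmostCommutativeRing using (AlmostCommutativeRing; fromCommutativeRing)

ℚ-ring : AlmostCommutativeRing 0ℓ 0ℓ
ℚ-ring = fromCommutativeRing +-*-commutativeRing (λ x → dec⇒maybe (0ℚ ≟ x))

sumFin-cong : ∀ n {f g : Fin n → ℚ} → (∀ i → f i ≡ g i) → sumFin n f ≡ sumFin n g
sumFin-cong zero    f≡g = refl
sumFin-cong (suc n) f≡g = cong₂ _+_ (f≡g zero) (sumFin-cong n (f≡g ∘ suc))

sumFin-zero : ∀ n {f : Fin n → ℚ} → (∀ i → f i ≡ 0ℚ) → sumFin n f ≡ 0ℚ
sumFin-zero zero    f≡0 = refl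
sumFin-zero (suc n) f≡0 = trans (cong₂ _+_ (f≡0 zero) (sumFin-zero n (f≡0 ∘ suc))) (+-identityˡ 0ℚ)

sumFin-+ : ∀ d m (f : Fin (d ℕ.+ m) → ℚ) →
  sumFin (d ℕ.+ m) f ≡ sumFin d (f ∘ (_↑ˡ m)) + sumFin m (f ∘ (d ↑ʳ_))
sumFin-+ zero    m f = sym (+-identityˡ (sumFin m f))
sumFin-+ (suc d) m f =
  trans (cong (f zero +_) (sumFin-+ d m (f ∘ suc))) (sym (+-assoc (f zero) _ _))

sumFin-*-− : ∀ n (c f g : Fin n → ℚ) →
  sumFin n (λ i → c i * (f i - g i)) ≡ sumFin n (λ i → c i * f i) - sumFin n (λ i → c i * g i)
sumFin-*-− zero    c f g = refl
sumFin-*-− (suc n) c f g = trans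
  (cong (c zero * (f zero - g zero) +_) (sumFin-*-− n (c ∘ suc) (f ∘ suc) (g ∘ suc)))
  (interchange (c zero) (f zero) (g zero) _ _)
  where
  interchange : ∀ a x y s t → a * (x - y) + (s - t) ≡ (a * x + s) - (a * y + t)
  interchange = solve-∀ ℚ-ring

module _ {X : Set} where

  lincomb : ∀ {m} → (Fin m → ℚ) → (Fin m → X → ℚ) → X → ℚ
  lincomb {m} c v x = sumFin m (λ i → c i * v i x)

  lincomb-zero : ∀ {m} {c : Fin m → ℚ} (v : Fin m → X → ℚ) → (∀ i → c i ≡ 0ℚ) → ∀ x → lincomb c v x ≡ 0ℚ
  lincomb-zero {m} v c≡0 x = sumFin-zero m (λ i → trans (cong (_* v i x) (c≡0 i)) (*-zeroˡ (v i x)))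

  lincomb-++ : ∀ {d m} (c : Fin (d ℕ.+ m) → ℚ) (u : Fin d → X → ℚ) (w : Fin m → X → ℚ) x →
    lincomb c (u ++ w) x ≡ lincomb (c ∘ (_↑ˡ m)) u x + lincomb (c ∘ (d ↑ʳ_)) w x
  lincomb-++ {d} {m} c u w x = trans (sumFin-+ d m _) (cong₂ _+_
    (sumFin-cong d (λ i → cong (λ f → c (i ↑ˡ m) * f x) (lookup-++ˡ u w i)))
    (sumFin-cong m (λ j → cong (λ f → c (d ↑ʳ j) * f x) (lookup-++ʳ u w j))))

Δ : ∀ {r} → (Subset (suc r) → ℚ) → Subset r → ℚ
Δ f S = f (inside ∷ S) - f (outside ∷ S)

lincomb-Δ : ∀ {r m} (c : Fin m → ℚ) (u : Fin m → Subset (suc r) → ℚ) S →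
  lincomb c (Δ ∘ u) S ≡ Δ (lincomb c u) S
lincomb-Δ {m = m} c u S = sumFin-*-− m c (λ i → u i (inside ∷ S)) (λ i → u i (outside ∷ S))

LinIndep-resp : ∀ {r m} {v w : Fin m → Subset r → ℚ} → (∀ i T → v i T ≡ w i T) → LinIndep m v → LinIndep m w
LinIndep-resp {m = m} v≡w v-indep c wc≡0 =
  v-indep c (λ T → trans (sumFin-cong m (λ i → cong (c i *_) (v≡w i T))) (wc≡0 T))

elim-↑ : ∀ {d m} (P : Fin (d ℕ.+ m) → Set) → (∀ i → P (i ↑ˡ m)) → (∀ j → P (d ↑ʳ j)) → ∀ k → P k
elim-↑ {d} {m} P left right k =
  subst P (join-splitAt d m k) ([_,_] {C = P ∘ join d m} left right (splitAt d k))

LinIndep-++ : ∀ {r d m} (u : Fin d → Subset (suc r) → ℚ) (v : Fin m → Subset r → ℚ) →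
  LinIndep d (Δ ∘ u) → LinIndep m v → LinIndep (d ℕ.+ m) (u ++ (λ j → v j ∘ tail))
LinIndep-++ {r} {d} {m} u v Δu-indep v-indep c c≡0 = elim-↑ (λ k → c k ≡ 0ℚ) a≡0 b≡0
  where
  open ≡-Reasoning
  a : Fin d → ℚ
  a = c ∘ (_↑ˡ m)
  b : Fin m → ℚ
  b = c ∘ (d ↑ʳ_)
  split : ∀ T → lincomb a u T + lincomb b v (tail T) ≡ 0ℚ
  split T = trans (sym (lincomb-++ c u (λ j → v j ∘ tail) T)) (c≡0 T)
  a≡0 : ∀ i → a i ≡ 0ℚ
  a≡0 = Δu-indep a λ S → begin
    lincomb a (Δ ∘ u) S
      ≡⟨ lincomb-Δ a u S ⟩
    lincomb a u (inside ∷ S) - lincomb a u (outside ∷ S)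
      ≡⟨ cancel-+ʳ (lincomb a u (inside ∷ S)) (lincomb a u (outside ∷ S)) (lincomb b v S) ⟩
    (lincomb a u (inside ∷ S) + lincomb b v S) - (lincomb a u (outside ∷ S) + lincomb b v S)
      ≡⟨ cong₂ _-_ (split (inside ∷ S)) (split (outside ∷ S)) ⟩
    0ℚ - 0ℚ
      ∎
    where
    cancel-+ʳ : ∀ x y z → x - y ≡ (x + z) - (y + z)
    cancel-+ʳ = solve-∀ ℚ-ring
  b≡0 : ∀ j → b j ≡ 0ℚ
  b≡0 = v-indep b λ S → begin
    lincomb b v S
      ≡⟨ sym (+-identityˡ _) ⟩
    0ℚ + lincomb b v S
      ≡⟨ cong (_+ lincomb b v S) (sym (lincomb-zero u a≡0 (outside ∷ S))) ⟩
    lincomb a u (outside ∷ S) + lincomb b v S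
      ≡⟨ split (outside ∷ S) ⟩
    0ℚ
      ∎

ind-⊥ : ∀ {n} (i : Fin n) → ind {n} ⊥ i ≡ 0ℚ
ind-⊥ i rewrite lookup-replicate i outside = refl

sumFin-sift : ∀ n (c : Fin n → ℚ) j → sumFin n (λ i → c i * ind ⁅ j ⁆ i) ≡ c j
sumFin-sift (suc n) c zero = begin
  c zero * 1ℚ + sumFin n (λ i → c (suc i) * ind ⊥ i)
    ≡⟨ cong₂ _+_ (*-identityʳ (c zero)) (sumFin-zero n (λ i → trans (cong (c (suc i) *_) (ind-⊥ i)) (*-zeroʳ (c (suc i))))) ⟩
  c zero + 0ℚ
    ≡⟨ +-identityʳ (c zero) ⟩
  c zero
    ∎
  where open ≡-Reasoning
sumFin-sift (suc n) c (suc j) =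
  trans (cong₂ _+_ (*-zeroʳ (c zero)) (sumFin-sift n (c ∘ suc) j)) (+-identityˡ (c (suc j)))

star-independent : ∀ n → LinIndep n (λ i (S : Subset (suc n)) → ind S (suc i) - ind S zero)
star-independent n c c≡0 j = begin
  c j
    ≡⟨ sym (sumFin-sift n c j) ⟩
  sumFin n (λ i → c i * ind ⁅ j ⁆ i)
    ≡⟨ sumFin-cong n (λ i → cong (c i *_) (sym (+-identityʳ (ind ⁅ j ⁆ i)))) ⟩
  sumFin n (λ i → c i * (ind ⁅ j ⁆ i - 0ℚ))
    ≡⟨ c≡0 (outside ∷ ⁅ j ⁆) ⟩
  0ℚ
    ∎
  where open ≡-Reasoning

liftQuad : ∀ {r} → Quad r → Quad (suc r)
liftQuad (quad w x y z w≢x w≢y w≢z x≢y x≢z y≢z) =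
  quad (suc w) (suc x) (suc y) (suc z)
       (w≢x ∘ suc-injective) (w≢y ∘ suc-injective) (w≢z ∘ suc-injective)
       (x≢y ∘ suc-injective) (x≢z ∘ suc-injective) (y≢z ∘ suc-injective)

vecF-liftQuad : ∀ {r} (q : Quad r) T → vecF (liftQuad q) T ≡ vecF q (tail T)
vecF-liftQuad (quad _ _ _ _ _ _ _ _ _ _) (_ ∷ _) = refl

cone : ∀ {r} (x y z : Fin r) → x ≢ y → x ≢ z → y ≢ z → Quad (suc r)
cone x y z x≢y x≢z y≢z =
  quad zero (suc x) (suc y) (suc z) (λ ()) (λ ()) (λ ())
       (x≢y ∘ suc-injective) (x≢z ∘ suc-injective) (y≢z ∘ suc-injective)

Δ-vecF-cone : ∀ {r} (x y z : Fin r) x≢y x≢z y≢z S → Δ (vecF (cone x y z x≢y x≢z y≢z)) S ≡ ind S y - ind S z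
Δ-vecF-cone x y z _ _ _ S = unit-step (ind S x) (ind S y - ind S z)
  where
  unit-step : ∀ a b → (1ℚ - a) * b - (0ℚ - a) * b ≡ b
  unit-step = solve-∀ ℚ-ring

starQuad : ∀ {k} → Fin (2 ℕ.+ k) → Quad (4 ℕ.+ k)
starQuad zero    = cone 2F 1F 0F (λ ()) (λ ()) (λ ())
starQuad (suc i) = cone 1F (suc (suc i)) 0F (λ ()) (λ ()) (λ ())

Δ-vecF-starQuad : ∀ {k} (i : Fin (2 ℕ.+ k)) S → ind S (suc i) - ind S zero ≡ Δ (vecF (starQuad i)) S
Δ-vecF-starQuad zero    S = sym (Δ-vecF-cone 2F 1F 0F (λ ()) (λ ()) (λ ()) S)
Δ-vecF-starQuad (suc i) S = sym (Δ-vecF-cone 1F (suc (suc i)) 0F (λ ()) (λ ()) (λ ()) S)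

IndependentQuads : ℕ → ℕ → Set
IndependentQuads r m = Σ (Fin m → Quad r) (λ Γ → LinIndep m (λ i → vecF (Γ i)))

extend : ∀ {k m} → IndependentQuads (3 ℕ.+ k) m → IndependentQuads (4 ℕ.+ k) (2 ℕ.+ k ℕ.+ m)
extend {k} (Γ , Γ-indep) = starQuad ++ (liftQuad ∘ Γ) , LinIndep-resp vecF-++
  (LinIndep-++ (vecF ∘ starQuad) (vecF ∘ Γ)
    (LinIndep-resp Δ-vecF-starQuad (star-independent (2 ℕ.+ k))) Γ-indep)
  where
  vecF-++ : ∀ i T → ((vecF ∘ starQuad) ++ (λ j → vecF (Γ j) ∘ tail)) i T ≡ vecF ((starQuad ++ (liftQuad ∘ Γ)) i) T
  vecF-++ i T with splitAt (2 ℕ.+ k) i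
  ... | inj₁ _ = refl
  ... | inj₂ j = sym (vecF-liftQuad (Γ j) T)

C2∸-step : ∀ n m → suc n C 2 ∸ suc n ≤ m → suc (suc n) C 2 ∸ suc (suc n) ≤ n ℕ.+ m
C2∸-step n m bound = subst (λ t → t ∸ suc (suc n) ≤ n ℕ.+ m) pascal
  (m≤n+o⇒m∸n≤o (n ℕ.+ suc n C 2) (suc n) (begin
    n ℕ.+ suc n C 2                 ≤⟨ +-monoʳ-≤ n (≤-trans (m≤n+m∸n (suc n C 2) (suc n)) (+-monoʳ-≤ (suc n) bound)) ⟩
    n ℕ.+ (suc n ℕ.+ m)             ≡⟨ +-suc n (n ℕ.+ m) ⟩
    suc n ℕ.+ (n ℕ.+ m)             ∎))
  where
  open ≤-Reasoning
  pascal : suc n ℕ.+ suc n C 2 ≡ suc (suc n) C 2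
  pascal = trans (cong (ℕ._+ suc n C 2) (sym (nC1≡n (suc n)))) (nCk+nC[k+1]≡[n+1]C[k+1] (suc n) 1)

independentQuads : ∀ k → Σ ℕ (λ m → ((3 ℕ.+ k) C 2 ∸ (3 ℕ.+ k) ≤ m) × IndependentQuads (3 ℕ.+ k) m)
independentQuads zero = 0 , z≤n , (λ ()) , (λ _ _ ())
independentQuads (suc k) with independentQuads k
... | m , bound , family = 2 ℕ.+ k ℕ.+ m , C2∸-step (2 ℕ.+ k) m bound , extend family

lemma6 : (r : ℕ) → 4 ≤ r →
    Σ ℕ (λ m → ((r C 2) ∸ r ≤ m) × Σ (Fin m → Quad r) (λ Γ → LinIndep m (λ i → vecF (Γ i))))
lemma6 (suc (suc (suc k))) (s≤s (s≤s (s≤s _))) = independentQuads k
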